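{- Let $q\geq 2$. (i) For every completely regular code in $H(2,q)$ with covering radius $1$, eigenvalue $\lambda_2(2,q)$ and parameter $\gamma$, there is a completely regular code in $H(3,q)$ with covering radius $1$, eigenvalue $\lambda_2(3,q)$ and the same parameter $\gamma$. (ii) For every even integer $\gamma$ with $2\leq\gamma\leq q$ there is a completely regular code in $H(3,q)$ with covering radius $1$, eigenvalue $\lambda_2(3,q)$ and parameter $\gamma$.
   Context: Let $\mathcal{A}$ be a set of size $q$; $H(n,q)$ has vertex set $\mathcal{A}^n$, tuples adjacent iff they differ in exactly one position; it is $n(q-1)$-regular and $\lambda_i(n,q)=n(q-1)-qi$. A set $C$ of vertices is a completely regular code with covering radius $1$ if $C$ is a nonempty proper subset and there are integers $\beta,\gamma\geq1$ such that every vertex of $C$ has exactly $\beta$ neighbours outside $C$ and every vertex outside $C$ has exactly $\gamma$ neighbours in $C$; "eigenvalue $\lambda_2(n,q)$" means $n(q-1)-(\beta+\gamma)=\lambda_2(n,q)$, i.e. $\beta+\gamma=2q$. -}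

module Defs where

open import Data.Nat using (ℕ; zero; suc; _+_; _*_; _∸_)
open import Data.Bool using (Bool; true; false; _∧_; not)
open import Data.Fin using (Fin)
open import Data.Fin.Properties using (_≟_)
open import Data.Vec using (Vec; []; _∷_)
open import Data.List using (List; []; _∷_; map; concatMap; length; filterᵇ; allFin)
open import Data.Integer using (ℤ; +_; _-_)
open import Data.Product using (Σ; ∃; _×_)
open import Relation.Binary.PropositionalEquality using (_≡_)
open import Relation.Nullary.Decidable using (⌊_⌋)
open import Data.Nat using (_≡ᵇ_; _≤_)

Vertex : ℕ → ℕ → Set
Vertex n q = Vec (Fin q) n

dist : ∀ {n q} → Vertex n q → Vertex n q → ℕ
dist [] [] = 0
dist (a ∷ u) (b ∷ v) with ⌊ a ≟ b ⌋
... | true  = dist u v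
... | false = suc (dist u v)

adjᵇ : ∀ {n q} → Vertex n q → Vertex n q → Bool
adjᵇ u v = dist u v ≡ᵇ 1

allVertices : (n q : ℕ) → List (Vertex n q)
allVertices zero    q = [] ∷ []
allVertices (suc n) q =
  concatMap (λ a → map (a ∷_) (allVertices n q)) (allFin q)

Code : ℕ → ℕ → Set
Code n q = Vertex n q → Bool

nbrsIn : ∀ {n q} → Code n q → Vertex n q → ℕ
nbrsIn {n} {q} C v = length (filterᵇ (λ w → adjᵇ v w ∧ C w) (allVertices n q))

nbrsOut : ∀ {n q} → Code n q → Vertex n q → ℕ
nbrsOut {n} {q} C v = length (filterᵇ (λ w → adjᵇ v w ∧ not (C w)) (allVertices n q))

IsCRC1 : (n q : ℕ) → Code n q → ℕ → ℕ → Set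
IsCRC1 n q C β γ =
  (∃ λ v → C v ≡ true) ×
  (∃ λ v → C v ≡ false) ×
  1 ≤ β × 1 ≤ γ ×
  (∀ v → C v ≡ true → nbrsOut C v ≡ β) ×
  (∀ v → C v ≡ false → nbrsIn C v ≡ γ)

eigenvalue : ℕ → ℕ → ℕ → ℤ
eigenvalue n q i = + (n * (q ∸ 1)) - + (q * i)

HasEigenvalueλ₂ : (n q β γ : ℕ) → Set
HasEigenvalueλ₂ n q β γ = + (n * (q ∸ 1)) - + (β + γ) ≡ eigenvalue n q 2

ExistsCRC1λ₂ : (n q γ : ℕ) → Set
ExistsCRC1λ₂ n q γ =
  Σ (Code n q) λ C → ∃ λ β → IsCRC1 n q C β γ × HasEigenvalueλ₂ n q β γ

-- Adding a free coordinate, C ↦ A × C, keeps β and γ: a neighbour of (x, u) either changes only x,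
-- and then lies in the same class as (x, u), or is (x, u′) with u′ a neighbour of u. Since the
-- eigenvalue condition reads β + γ = 2q independently of n, this lifts (i) from H(2,q) to H(3,q).
-- For (ii) write γ = 2s: the circulant code {(a, b) : (a + b) mod q < s} of H(2,q) meets every line
-- in exactly s vertices, so β = 2(q − s) and γ = 2s, and it lifts to H(3,q) in the same way.
module Submission where

open import Defs
import Data.Integer as ℤ
import Data.Integer.Properties as ℤ
import Data.Nat.Properties as ℕ
open import Algebra.Properties.CommutativeSemigroup ℕ.+-commutativeSemigroup using (interchange)
open import Algebra.Properties.AbelianGroup ℤ.+-0-abelianGroup using (∙-cancelˡ)
open import Algebra.Properties.CommutativeMonoid.Sum ℕ.+-0-commutativeMonoid
  using (sum-syntax; sum-cong-≗; sum-replicate-zero; sum-init-last; ∑-distrib-+)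
open import Data.Bool using (Bool; true; false; _∧_; not; if_then_else_)
open import Data.Fin using (Fin; zero; suc; toℕ; fromℕ; fromℕ<; inject₁)
open import Data.Fin.Properties using (_≟_; toℕ<n; toℕ-fromℕ; toℕ-fromℕ<; toℕ-inject₁)
open import Data.List using (List; []; _∷_; _++_; map; concat; tabulate; length; filterᵇ)
open import Data.List.Properties using (length-++; filter-++; map-tabulate)
open import Data.Nat using (ℕ; zero; suc; _+_; _*_; _∸_; _≤_; _<_; _%_; _<ᵇ_; _≡ᵇ_; s≤s; z≤n; NonZero)
open import Data.Nat.DivMod using (m<n⇒m%n≡m; [m+n]%n≡m%n)
open import Data.Nat.Divisibility using (_∣_; divides)
open import Data.Product using (_×_; _,_)
open import Data.Vec using ([]; _∷_; head; tail)
open import Function using (_∘_; id)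
open import Relation.Binary.PropositionalEquality
open import Relation.Nullary using (yes; no)
open import Relation.Nullary.Decidable using (⌊_⌋; dec-true; dec-false)

𝟙 : Bool → ℕ
𝟙 true  = 1
𝟙 false = 0

count : {A : Set} → (A → Bool) → List A → ℕ
count p = length ∘ filterᵇ p

count-++ : {A : Set} (p : A → Bool) (xs ys : List A) →
           count p (xs ++ ys) ≡ count p xs + count p ys
count-++ p xs ys = trans (cong length (filter-++ _ xs ys)) (length-++ (filterᵇ p xs))

count-map : {A B : Set} (p : B → Bool) (f : A → B) (xs : List A) →
            count p (map f xs) ≡ count (p ∘ f) xs
count-map p f []       = refl
count-map p f (x ∷ xs) with p (f x)
... | true  = cong suc (count-map p f xs)
... | false = count-map p f xs

count-none : {A : Set} (xs : List A) → count (λ _ → false) xs ≡ 0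
count-none []       = refl
count-none (x ∷ xs) = count-none xs

count-concat-tabulate : ∀ {A : Set} {n} (p : A → Bool) (f : Fin n → List A) →
                        count p (concat (tabulate f)) ≡ ∑[ i < n ] count p (f i)
count-concat-tabulate {n = zero}  p f = refl
count-concat-tabulate {n = suc n} p f =
  trans (count-++ p (f zero) _) (cong (count p (f zero) +_) (count-concat-tabulate p (f ∘ suc)))

∑-pointMass : ∀ {q} (x : Fin q) (m : ℕ) → ∑[ a < q ] (if ⌊ x ≟ a ⌋ then m else 0) ≡ m
∑-pointMass {suc q} zero    m = trans (cong (m +_) (sum-replicate-zero q)) (ℕ.+-identityʳ m)
∑-pointMass {suc q} (suc x) m = trans (sum-cong-≗ shift) (∑-pointMass x m)
  where
  shift : ∀ i → (if ⌊ suc x ≟ suc i ⌋ then m else 0) ≡ (if ⌊ x ≟ i ⌋ then m else 0)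
  shift i with x ≟ i
  ... | yes _ = refl
  ... | no  _ = refl

count-allVertices : ∀ {n q} (p : Vertex (suc n) q → Bool) →
  count p (allVertices (suc n) q) ≡ ∑[ a < q ] count (p ∘ (a ∷_)) (allVertices n q)
count-allVertices {n} {q} p = begin
  count p (allVertices (suc n) q)
    ≡⟨ cong (count p ∘ concat) (map-tabulate id byHead) ⟩
  count p (concat (tabulate byHead))
    ≡⟨ count-concat-tabulate p byHead ⟩
  ∑[ a < q ] count p (byHead a)
    ≡⟨ sum-cong-≗ (λ a → count-map p (a ∷_) (allVertices n q)) ⟩
  ∑[ a < q ] count (p ∘ (a ∷_)) (allVertices n q)
    ∎
  where
  open ≡-Reasoning
  byHead : Fin q → List (Vertex (suc n) q)
  byHead a = map (a ∷_) (allVertices n q)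

count-dist≡0 : ∀ {n q} (u : Vertex n q) (P : Vertex n q → Bool) →
  count (λ w → (dist u w ≡ᵇ 0) ∧ P w) (allVertices n q) ≡ 𝟙 (P u)
count-dist≡0 [] P with P []
... | true  = refl
... | false = refl
count-dist≡0 {suc n} {q} (x ∷ u) P =
  trans (count-allVertices (λ w → (dist (x ∷ u) w ≡ᵇ 0) ∧ P w))
        (trans (sum-cong-≗ onLine) (∑-pointMass x (𝟙 (P (x ∷ u)))))
  where
  onLine : ∀ a → count (λ w → (dist (x ∷ u) (a ∷ w) ≡ᵇ 0) ∧ P (a ∷ w)) (allVertices n q)
                 ≡ (if ⌊ x ≟ a ⌋ then 𝟙 (P (x ∷ u)) else 0)
  onLine a with x ≟ a
  ... | yes refl = count-dist≡0 u (P ∘ (x ∷_))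
  ... | no  _    = count-none (allVertices n q)

-- P (x ∷ u) ≡ false is what lets the count along the first-coordinate line include x itself.
nbrsIn-∷ : ∀ {n q} (P : Code (suc n) q) (x : Fin q) (u : Vertex n q) → P (x ∷ u) ≡ false →
  nbrsIn P (x ∷ u) ≡ nbrsIn (P ∘ (x ∷_)) u + ∑[ a < q ] 𝟙 (P (a ∷ u))
nbrsIn-∷ {n} {q} P x u Pxu≡false = begin
  nbrsIn P (x ∷ u)
    ≡⟨ count-allVertices (λ w → adjᵇ (x ∷ u) w ∧ P w) ⟩
  ∑[ a < q ] count (λ w → adjᵇ (x ∷ u) (a ∷ w) ∧ P (a ∷ w)) (allVertices n q)
    ≡⟨ sum-cong-≗ onLine ⟩
  ∑[ a < q ] ((if ⌊ x ≟ a ⌋ then N else 0) + 𝟙 (P (a ∷ u)))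
    ≡⟨ ∑-distrib-+ (λ a → if ⌊ x ≟ a ⌋ then N else 0) (λ a → 𝟙 (P (a ∷ u))) ⟩
  ∑[ a < q ] (if ⌊ x ≟ a ⌋ then N else 0) + ∑[ a < q ] 𝟙 (P (a ∷ u))
    ≡⟨ cong (_+ ∑[ a < q ] 𝟙 (P (a ∷ u))) (∑-pointMass x N) ⟩
  N + ∑[ a < q ] 𝟙 (P (a ∷ u))
    ∎
  where
  open ≡-Reasoning
  N : ℕ
  N = nbrsIn (P ∘ (x ∷_)) u
  onLine : ∀ a → count (λ w → adjᵇ (x ∷ u) (a ∷ w) ∧ P (a ∷ w)) (allVertices n q)
                 ≡ (if ⌊ x ≟ a ⌋ then N else 0) + 𝟙 (P (a ∷ u))
  onLine a with x ≟ a
  ... | yes refl rewrite Pxu≡false = sym (ℕ.+-identityʳ N)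
  ... | no  _    = count-dist≡0 u (P ∘ (a ∷_))

nbrsIn-cylinder : ∀ {n q} (P : Code n q) (x : Fin q) (u : Vertex n q) → P u ≡ false →
  nbrsIn (P ∘ tail) (x ∷ u) ≡ nbrsIn P u
nbrsIn-cylinder {q = q} P x u Pu≡false = begin
  nbrsIn (P ∘ tail) (x ∷ u)         ≡⟨ nbrsIn-∷ (P ∘ tail) x u Pu≡false ⟩
  nbrsIn P u + ∑[ a < q ] 𝟙 (P u)   ≡⟨ cong (λ b → nbrsIn P u + ∑[ a < q ] 𝟙 b) Pu≡false ⟩
  nbrsIn P u + ∑[ a < q ] 0         ≡⟨ cong (nbrsIn P u +_) (sum-replicate-zero q) ⟩
  nbrsIn P u + 0                    ≡⟨ ℕ.+-identityʳ _ ⟩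
  nbrsIn P u                        ∎
  where open ≡-Reasoning

isCRC1-cylinder : ∀ {n q β γ} {C : Code n (suc q)} →
  IsCRC1 n (suc q) C β γ → IsCRC1 (suc n) (suc q) (C ∘ tail) β γ
isCRC1-cylinder {β = β} {γ} {C} ((v , v∈C) , (v′ , v′∉C) , 1≤β , 1≤γ , out≡β , in≡γ) =
  (zero ∷ v , v∈C) , (zero ∷ v′ , v′∉C) , 1≤β , 1≤γ , out≡β′ , in≡γ′
  where
  out≡β′ : ∀ w → C (tail w) ≡ true → nbrsOut (C ∘ tail) w ≡ β
  out≡β′ (x ∷ u) u∈C = trans (nbrsIn-cylinder (not ∘ C) x u (cong not u∈C)) (out≡β u u∈C)
  in≡γ′ : ∀ w → C (tail w) ≡ false → nbrsIn (C ∘ tail) w ≡ γ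
  in≡γ′ (x ∷ u) u∉C = trans (nbrsIn-cylinder C x u u∉C) (in≡γ u u∉C)

hasEigenvalueλ₂⇒β+γ≡2q : ∀ n q β γ → HasEigenvalueλ₂ n q β γ → β + γ ≡ q * 2
hasEigenvalueλ₂⇒β+γ≡2q n q β γ h =
  ℤ.+-injective (ℤ.neg-injective (∙-cancelˡ (ℤ.+ (n * (q ∸ 1))) (ℤ.- ℤ.+ (β + γ)) (ℤ.- ℤ.+ (q * 2)) h))

β+γ≡2q⇒hasEigenvalueλ₂ : ∀ n q β γ → β + γ ≡ q * 2 → HasEigenvalueλ₂ n q β γ
β+γ≡2q⇒hasEigenvalueλ₂ n q β γ β+γ≡2q = cong (λ s → ℤ.+ (n * (q ∸ 1)) ℤ.- ℤ.+ s) β+γ≡2q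

existsCRC1λ₂-cylinder : ∀ {n q γ} → ExistsCRC1λ₂ n (suc q) γ → ExistsCRC1λ₂ (suc n) (suc q) γ
existsCRC1λ₂-cylinder {n} {q} {γ} (C , β , crc , λ₂) =
  C ∘ tail , β , isCRC1-cylinder crc ,
  β+γ≡2q⇒hasEigenvalueλ₂ (suc n) (suc q) β γ (hasEigenvalueλ₂⇒β+γ≡2q n (suc q) β γ λ₂)

∑-one : ∀ q → ∑[ i < q ] 1 ≡ q
∑-one zero    = refl
∑-one (suc q) = cong suc (∑-one q)

∑-below : ∀ {q s} → s ≤ q → ∑[ i < q ] 𝟙 (toℕ i <ᵇ s) ≡ s
∑-below {q} z≤n       = sum-replicate-zero q
∑-below     (s≤s s≤q) = cong suc (∑-below s≤q)

∑-notBelow : ∀ {q s} → s ≤ q → ∑[ i < q ] 𝟙 (not (toℕ i <ᵇ s)) ≡ q ∸ s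
∑-notBelow {q} z≤n       = ∑-one q
∑-notBelow     (s≤s s≤q) = ∑-notBelow s≤q

∑-rotate : ∀ q (g : ℕ → ℕ) → g q ≡ g 0 → ∑[ i < q ] g (suc (toℕ i)) ≡ ∑[ i < q ] g (toℕ i)
∑-rotate q g gq≡g0 = ℕ.+-cancelˡ-≡ (g 0) _ _ (begin
  g 0 + ∑[ i < q ] g (suc (toℕ i))
    ≡⟨ sum-init-last (g ∘ toℕ) ⟩
  ∑[ i < q ] g (toℕ (inject₁ i)) + g (toℕ (fromℕ q))
    ≡⟨ cong₂ _+_ (sum-cong-≗ {q} (cong g ∘ toℕ-inject₁)) (trans (cong g (toℕ-fromℕ q)) gq≡g0) ⟩
  ∑[ i < q ] g (toℕ i) + g 0
    ≡⟨ ℕ.+-comm _ (g 0) ⟩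
  g 0 + ∑[ i < q ] g (toℕ i)
    ∎)
  where open ≡-Reasoning

∑-shift : ∀ q .{{_ : NonZero q}} (f : ℕ → ℕ) (m : ℕ) →
  ∑[ i < q ] f ((m + toℕ i) % q) ≡ ∑[ i < q ] f (toℕ i)
∑-shift q f zero    = sum-cong-≗ {q} (λ i → cong f (m<n⇒m%n≡m (toℕ<n i)))
∑-shift q f (suc m) = begin
  ∑[ i < q ] f ((suc m + toℕ i) % q)
    ≡⟨ sum-cong-≗ {q} (λ i → cong (f ∘ (_% q)) (sym (ℕ.+-suc m (toℕ i)))) ⟩
  ∑[ i < q ] f ((m + suc (toℕ i)) % q)
    ≡⟨ ∑-rotate q (λ k → f ((m + k) % q)) periodic ⟩
  ∑[ i < q ] f ((m + toℕ i) % q)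
    ≡⟨ ∑-shift q f m ⟩
  ∑[ i < q ] f (toℕ i)
    ∎
  where
  open ≡-Reasoning
  periodic : f ((m + q) % q) ≡ f ((m + 0) % q)
  periodic = cong f (trans ([m+n]%n≡m%n m q) (cong (_% q) (sym (ℕ.+-identityʳ m))))

nbrsIn-plane : ∀ {q} (P : Code 2 q) (x y : Fin q) → P (x ∷ y ∷ []) ≡ false →
  nbrsIn P (x ∷ y ∷ []) ≡ ∑[ b < q ] 𝟙 (P (x ∷ b ∷ [])) + ∑[ a < q ] 𝟙 (P (a ∷ y ∷ []))
nbrsIn-plane {q} P x y Pxy≡false =
  trans (nbrsIn-∷ P x (y ∷ []) Pxy≡false)
        (cong (_+ ∑[ a < q ] 𝟙 (P (a ∷ y ∷ []))) (nbrsIn-∷ (P ∘ (x ∷_)) y [] Pxy≡false))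

circulant : ∀ {q} .{{_ : NonZero q}} → (ℕ → Bool) → Code 2 q
circulant {q} φ w = φ ((toℕ (head w) + toℕ (head (tail w))) % q)

nbrsIn-circulant : ∀ {q} .{{_ : NonZero q}} (φ : ℕ → Bool) (x y : Fin q) →
  circulant φ (x ∷ y ∷ []) ≡ false →
  nbrsIn (circulant φ) (x ∷ y ∷ []) ≡ ∑[ i < q ] 𝟙 (φ (toℕ i)) + ∑[ i < q ] 𝟙 (φ (toℕ i))
nbrsIn-circulant {q} φ x y xy∉C =
  trans (nbrsIn-plane (circulant φ) x y xy∉C) (cong₂ _+_ (∑-shift q (𝟙 ∘ φ) (toℕ x)) column)
  where
  column : ∑[ a < q ] 𝟙 (φ ((toℕ a + toℕ y) % q)) ≡ ∑[ i < q ] 𝟙 (φ (toℕ i))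
  column = trans (sum-cong-≗ {q} (λ a → cong (𝟙 ∘ φ ∘ (_% q)) (ℕ.+-comm (toℕ a) (toℕ y))))
                 (∑-shift q (𝟙 ∘ φ) (toℕ y))

isCRC1-circulant : ∀ {q s} → 1 ≤ s → s < suc q →
  IsCRC1 2 (suc q) (circulant (_<ᵇ s)) (suc q ∸ s + (suc q ∸ s)) (s + s)
isCRC1-circulant {q} {s} 1≤s s<q =
  (zero ∷ zero ∷ [] , dec-true (0 ℕ.<? s) 1≤s) ,
  (zero ∷ fromℕ< s<q ∷ [] , nonMember) ,
  ℕ.≤-trans (ℕ.m<n⇒0<n∸m s<q) (ℕ.m≤m+n _ _) , ℕ.≤-trans 1≤s (ℕ.m≤m+n s s) ,
  (λ { (x ∷ y ∷ []) xy∈C → trans (nbrsIn-circulant (not ∘ (_<ᵇ s)) x y (cong not xy∈C))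
                                 (cong₂ _+_ (∑-notBelow s≤q) (∑-notBelow s≤q)) }) ,
  (λ { (x ∷ y ∷ []) xy∉C → trans (nbrsIn-circulant (_<ᵇ s) x y xy∉C)
                                 (cong₂ _+_ (∑-below s≤q) (∑-below s≤q)) })
  where
  s≤q : s ≤ suc q
  s≤q = ℕ.<⇒≤ s<q
  nonMember : (toℕ (fromℕ< s<q) % suc q <ᵇ s) ≡ false
  nonMember = begin
    (toℕ (fromℕ< s<q) % suc q <ᵇ s) ≡⟨ cong (λ k → k % suc q <ᵇ s) (toℕ-fromℕ< s<q) ⟩
    (s % suc q <ᵇ s)                 ≡⟨ cong (_<ᵇ s) (m<n⇒m%n≡m s<q) ⟩
    (s <ᵇ s)                         ≡⟨ dec-false (s ℕ.<? s) (ℕ.n≮n s) ⟩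
    false                            ∎
    where open ≡-Reasoning

existsCRC1λ₂-plane : ∀ {q γ} → 2 ∣ γ → 2 ≤ γ → γ ≤ suc q → ExistsCRC1λ₂ 2 (suc q) γ
existsCRC1λ₂-plane {q} (divides s refl) 2≤γ γ≤q =
  subst (ExistsCRC1λ₂ 2 (suc q)) (sym s*2≡s+s)
    ( circulant (_<ᵇ s) , β , isCRC1-circulant 1≤s s<q
    , β+γ≡2q⇒hasEigenvalueλ₂ 2 (suc q) β (s + s) β+γ≡2q )
  where
  s*2≡s+s : s * 2 ≡ s + s
  s*2≡s+s = trans (ℕ.*-comm s 2) (cong (s +_) (ℕ.+-identityʳ s))
  1≤s : 1 ≤ s
  1≤s = ℕ.*-cancelʳ-≤ 1 s 2 2≤γ
  s<q : s < suc q
  s<q = ℕ.<-≤-trans (ℕ.m<m+n s 1≤s) (subst (_≤ suc q) s*2≡s+s γ≤q)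
  β : ℕ
  β = suc q ∸ s + (suc q ∸ s)
  β+γ≡2q : β + (s + s) ≡ suc q * 2
  β+γ≡2q = begin
    β + (s + s)                        ≡⟨ interchange (suc q ∸ s) (suc q ∸ s) s s ⟩
    (suc q ∸ s + s) + (suc q ∸ s + s)  ≡⟨ cong₂ _+_ (ℕ.m∸n+n≡m (ℕ.<⇒≤ s<q)) (ℕ.m∸n+n≡m (ℕ.<⇒≤ s<q)) ⟩
    suc q + suc q                      ≡⟨ cong (suc q +_) (sym (ℕ.+-identityʳ (suc q))) ⟩
    2 * suc q                          ≡⟨ ℕ.*-comm 2 (suc q) ⟩
    suc q * 2                          ∎
    where open ≡-Reasoning

proposition5 : (q : ℕ) → 2 ≤ q →
    ((C : Code 2 q) (β γ : ℕ) → IsCRC1 2 q C β γ → HasEigenvalueλ₂ 2 q β γ →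
      ExistsCRC1λ₂ 3 q γ)
    ×
    ((γ : ℕ) → 2 ∣ γ → 2 ≤ γ → γ ≤ q → ExistsCRC1λ₂ 3 q γ)
proposition5 (suc q) _ =
  (λ C β γ crc λ₂ → existsCRC1λ₂-cylinder (C , β , crc , λ₂)) ,
  (λ γ 2∣γ 2≤γ γ≤q → existsCRC1λ₂-cylinder (existsCRC1λ₂-plane 2∣γ 2≤γ γ≤q))
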